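{- Let $\mathcal B$ be the free twisted algebra on generators $\alpha_S$, $S\in\mathcal P$ nonempty, made into a twisted bialgebra by declaring the $\alpha_S$ primitive. Then the linear map $\mathcal T\to\mathcal T_{\mathcal B}$ sending the generator $1_S$ of $\mathcal T$ to the characteristic map $1_S$ is an isomorphism of algebras; equivalently, the elements $1_\emptyset$ and $1_{S_1}\ast\cdots\ast 1_{S_k}$ ($k\ge 1$, $S_i\in\mathcal P$ nonempty and pairwise disjoint) are linearly independent in $\mathcal T_{\mathcal B}$.
   Context: Let $\mathbf k$ be a field and $\mathcal P$ the set of finite subsets of the positive integers. $\mathcal T$ is the associative $\mathbf k$-algebra (product $\ast$) generated by symbols $1_S$, $S\in\mathcal P$, subject to the relations $1_{S_1}\ast\cdots\ast 1_{S_n}=0$ whenever $S_i\cap S_j\neq\emptyset$ for some $i\neq j$, and $1_\emptyset\ast 1_S=1_S\ast 1_\emptyset=1_S$. The twisted bialgebra $\mathcal B$: as a species (functor from elements of $\mathcal P$ with bijections to vector spaces), $\mathcal B(S)$ has basis $1$ (if $S=\emptyset$) and the products $\alpha_{S_1}\cdots\alpha_{S_k}$ over all ordered sequences $(S_1,\dots,S_k)$ of nonempty pairwise disjoint sets with $S_1\cup\cdots\cup S_k=S$; bijections $S\to T$ act by relabelling the sets; the product is concatenation; the coproduct is $\delta(\alpha_{S_1}\cdots\alpha_{S_k})=\sum_{\{i_1<\dots<i_l\}\sqcup\{j_1<\dots<j_{k-l}\}=\{1,\dots,k\}}\alpha_{S_{i_1}}\cdots\alpha_{S_{i_l}}\otimes\alpha_{S_{j_1}}\cdots\alpha_{S_{j_{k-l}}}$,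 taking values in $(\mathcal B\otimes\mathcal B)(S)=\bigoplus_{T\sqcup U=S}\mathcal B(T)\otimes\mathcal B(U)$. For a twisted bialgebra $B$ (with $B_S=B(S)$, product $m$, coproduct $\delta$), $\mathrm{End}_{\mathcal P}(B)$ is the space of families of linear maps $(f_S:B_S\to B_S)_S$ with convolution $f\ast g=m\circ(f\otimes g)\circ\delta$ ($f\otimes g$ acting on $B_T\otimes B_V$ by $f_T\otimes g_V$); the characteristic map $1_S$ is the identity on $B_S$ and $0$ on the other components; the twisted descent algebra $\mathcal T_B$ is the $\ast$-subalgebra generated by all $1_S$. -}

module Defs where

open import Level using (Level; _⊔_; suc)
open import Data.Bool using (Bool; true; false; if_then_else_; _∧_)
open import Data.Nat using (ℕ; _<_; _≡ᵇ_)
open import Data.Nat.Properties using () renaming (_≟_ to _≟ℕ_)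
open import Data.Fin using (Fin)
open import Data.List using (List; []; _∷_; _++_; concat; concatMap; map; allFin)
open import Data.Bool.ListAction using (all; any)
open import Data.List.Properties using (≡-dec)
open import Data.List.Relation.Unary.All using (All)
open import Data.List.Relation.Unary.AllPairs using (AllPairs)
open import Data.List.Relation.Unary.Linked using (Linked)
open import Data.List.Membership.Propositional using (_∈_)
open import Data.Product using (_×_; _,_; Σ; ∃)
open import Data.Empty using (⊥)
open import Relation.Nullary using (¬_; yes; no)
open import Relation.Binary.PropositionalEquality using (_≡_)
open import Algebra.Bundles using (CommutativeRing)

record Field (c ℓ : Level) : Set (suc (c ⊔ ℓ)) where
  field
    commutativeRing : CommutativeRing c ℓ
  open CommutativeRing commutativeRing public
  field
    1≉0     : ¬ (1# ≈ 0#)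
    inverse : ∀ x → ¬ (x ≈ 0#) → Σ Carrier (λ y → (x * y) ≈ 1#)

-- Finite subsets of the positive integers, in canonical form:
-- strictly increasing lists of positive naturals.

FSet : Set
FSet = List ℕ

Canonical : FSet → Set
Canonical S = Linked _<_ S × All (0 <_) S

Nonempty : FSet → Set
Nonempty S = ¬ (S ≡ [])

Disjoint : FSet → FSet → Set
Disjoint S T = ∀ n → n ∈ S → n ∈ T → ⊥

_⊆ᵇ_ : List ℕ → List ℕ → Bool
A ⊆ᵇ B = all (λ a → any (λ b → a ≡ᵇ b) B) A

_≐ᵇ_ : List ℕ → List ℕ → Bool
A ≐ᵇ B = (A ⊆ᵇ B) ∧ (B ⊆ᵇ A)

-- Words α_{S₁}⋯α_{S_k}.  A word is a basis element of 𝓑(S) with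
-- S = S₁ ∪ ⋯ ∪ S_k when the S_i are nonempty and pairwise disjoint.

Word : Set
Word = List FSet

ValidWord : Word → Set
ValidWord w = All (λ S → Canonical S × Nonempty S) w × AllPairs Disjoint w

-- Underlying set of a word (as a list, possibly non-canonical).
support : Word → List ℕ
support = concat

_≟W_ : (u v : Word) → Relation.Nullary.Dec (u ≡ v)
_≟W_ = ≡-dec (≡-dec _≟ℕ_)

-- All ways to split a sequence into two complementary subsequences
-- (positions {i₁<…<i_l} ⊔ {j₁<…<j_{k-l}}), i.e. the coproduct δ.
splits : {A : Set} → List A → List (List A × List A)
splits [] = ([] , []) ∷ []
splits (x ∷ xs) = concatMap (λ { (u , v) → (x ∷ u , v) ∷ (u , x ∷ v) ∷ [] }) (splits xs)

module TwistedDescent {c ℓ : Level} (k : Field c ℓ) where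
  open Field k

  -- Finite formal k-linear combinations of words (elements of 𝓑).
  LinComb : Set c
  LinComb = List (Carrier × Word)

  coeff : LinComb → Word → Carrier
  coeff [] w = 0#
  coeff ((a , u) ∷ xs) w with u ≟W w
  ... | yes _ = a + coeff xs w
  ... | no  _ = coeff xs w

  scale : Carrier → LinComb → LinComb
  scale a = map (λ { (b , u) → (a * b , u) })

  mulLC : LinComb → LinComb → LinComb
  mulLC x y = concatMap (λ { (a , u) → map (λ { (b , v) → (a * b , u ++ v) }) y }) x

  -- An element of End_𝓟(𝓑): a family of linear maps f_S : 𝓑_S → 𝓑_S,
  -- given by its values on basis words (the component S of a word w
  -- being its support).
  End : Set c
  End = Word → LinComb

  _⊛_ : End → End → End
  (f ⊛ g) w = concatMap (λ { (u , v) → mulLC (f u) (g v) }) (splits w)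

  char : FSet → End
  char S w = if support w ≐ᵇ S then (1# , w) ∷ [] else []

  charProd : List FSet → End
  charProd []           = char []
  charProd (S ∷ [])     = char S
  charProd (S ∷ T ∷ Ss) = char S ⊛ charProd (T ∷ Ss)

  linComb : {n : ℕ} → (Fin n → Carrier) → (Fin n → End) → End
  linComb {n} cs F w = concatMap (λ i → scale (cs i) (F i w)) (allFin n)

  IsZeroEnd : End → Set ℓ
  IsZeroEnd f = ∀ w → ValidWord w → ∀ v → coeff (f w) v ≈ 0#

AdmissibleSeq : List FSet → Set
AdmissibleSeq = ValidWord

{-# OPTIONS --safe #-}
-- Evaluate 1_{T₁} ∗ ⋯ ∗ 1_{T_l} on a basis word w = α_{S₁}⋯α_{S_k}.  Every word
-- it produces is a concatenation u₁⋯u_l of nonempty subwords of w with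
-- supp u_i = T_i, so l ≤ k, and l = k forces the word to be α_{T₁}⋯α_{T_l}.
-- On the other hand the coefficient of w in (1_{S₁} ∗ ⋯ ∗ 1_{S_k})(w) is 1: in
-- 1_{S₁} ∗ (1_{S₂} ∗ ⋯ ∗ 1_{S_k}) only the split of w into α_{S₁} and
-- α_{S₂}⋯α_{S_k} contributes.  Hence, for w = σ_i, the coefficient of w in
-- Σ_j c_j 1_{σ_j}(w) is c_i plus multiples of c_j with σ_j shorter than σ_i,
-- and induction on the length of σ_i gives c_i = 0.
module Submission where

open import Defs
open import Level using (Level)
open import Function.Definitions using (Injective)
open import Algebra.Bundles using (CommutativeMonoid)
import Algebra.Properties.CommutativeMonoid.Sum as MonoidSum
open import Data.Bool using (true; false; T; if_then_else_)
open import Data.Bool.Properties using (T-∧)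
open import Data.Empty using (⊥-elim)
open import Data.Fin using (Fin; zero; suc; punchIn)
open import Data.Fin.Properties using (punchInᵢ≢i)
open import Data.List using (List; []; _∷_; _++_; concat; concatMap; length; tabulate)
open import Data.List.Properties using (++-identityʳ; ++-cancelˡ; ∷-injectiveˡ; length-++; concatMap-++)
open import Data.List.Membership.Propositional.Properties using (∈-++⁺ˡ; ∈-++⁺ʳ)
open import Data.List.Relation.Binary.Subset.Propositional using (_⊆_)
open import Data.List.Relation.Unary.All as All using (All; []; _∷_)
open import Data.List.Relation.Unary.All.Properties using (all⁺; all⁻; concat⁺; map⁺)
open import Data.List.Relation.Unary.AllPairs using (_∷_)
open import Data.List.Relation.Unary.Any as Any using (here; there)
open import Data.List.Relation.Unary.Any.Properties using (any⁺; any⁻; ¬Any[])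
open import Data.List.Relation.Unary.Linked as Linked using (Linked)
open import Data.List.Relation.Unary.Linked.Properties using (Linked⇒AllPairs)
open import Data.Nat using (ℕ; zero; suc; _<_; _≤_; s≤s; z≤n)
open import Data.Nat.Induction using (<-wellFounded)
open import Data.Nat.Properties using (≡ᵇ⇒≡; ≡⇒≡ᵇ; <-trans; <-asym; <-irrefl; <⇒≤; ≤-refl; ≤-trans; m≤n+m; _<?_)
open import Data.Product using (_×_; _,_; proj₁; proj₂)
open import Data.Sum using (_⊎_; inj₁; inj₂)
open import Data.Unit using (tt)
open import Function using (_∘_; Equivalence)
import Induction.WellFounded as WF
import Relation.Binary.Construct.On as On
open import Relation.Binary.PropositionalEquality using (_≡_; _≢_; refl; sym; trans; cong; cong₂; subst)
import Relation.Binary.Reasoning.Setoid as ≈-Reasoning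
open import Relation.Nullary using (¬_; yes; no)

concatMap-concatMap : ∀ {a b c} {A : Set a} {B : Set b} {C : Set c}
                      (g : B → List C) (f : A → List B) (xs : List A) →
                      concatMap g (concatMap f xs) ≡ concatMap (concatMap g ∘ f) xs
concatMap-concatMap g f []       = refl
concatMap-concatMap g f (x ∷ xs) =
  trans (concatMap-++ g (f x) (concatMap f xs)) (cong (concatMap g (f x) ++_) (concatMap-concatMap g f xs))

splits-All : ∀ {p} {A : Set} {P : A → Set p} {xs : List A} → All P xs →
             All (λ s → All P (proj₁ s) × All P (proj₂ s)) (splits xs)
splits-All []         = ([] , []) ∷ []
splits-All (px ∷ pxs) =
  concat⁺ (map⁺ (All.map (λ (pu , pv) → (px ∷ pu , pv) ∷ (pu , px ∷ pv) ∷ []) (splits-All pxs)))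

⊆ᵇ⇒⊆ : ∀ {A B} → T (A ⊆ᵇ B) → A ⊆ B
⊆ᵇ⇒⊆ {A} {B} A⊆ᵇB a∈A =
  Any.map (≡ᵇ⇒≡ _ _) (any⁻ _ B (All.lookup (all⁺ _ A A⊆ᵇB) a∈A))

⊆⇒⊆ᵇ : ∀ {A B} → A ⊆ B → T (A ⊆ᵇ B)
⊆⇒⊆ᵇ {A} {B} A⊆B = all⁻ _ (All.tabulate (λ a∈A → any⁺ _ (Any.map (≡⇒≡ᵇ _ _) (A⊆B a∈A))))

≐ᵇ⇒⊆ : ∀ {A B} → T (A ≐ᵇ B) → A ⊆ B
≐ᵇ⇒⊆ {A} {B} = ⊆ᵇ⇒⊆ ∘ proj₁ ∘ Equivalence.to (T-∧ {A ⊆ᵇ B})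

≐ᵇ⇒⊇ : ∀ {A B} → T (A ≐ᵇ B) → B ⊆ A
≐ᵇ⇒⊇ {A} {B} = ⊆ᵇ⇒⊆ ∘ proj₂ ∘ Equivalence.to (T-∧ {A ⊆ᵇ B})

≐ᵇ-refl : ∀ A → T (A ≐ᵇ A)
≐ᵇ-refl A = Equivalence.from (T-∧ {A ⊆ᵇ A}) (A⊆ᵇA , A⊆ᵇA)
  where
  A⊆ᵇA : T (A ⊆ᵇ A)
  A⊆ᵇA = ⊆⇒⊆ᵇ {A} (λ a∈A → a∈A)

head<tail : ∀ {x xs} → Linked _<_ (x ∷ xs) → All (x <_) xs
head<tail sorted with Linked⇒AllPairs <-trans sorted
... | x<xs ∷ _ = x<xs

strictlySorted-tail-⊆ : ∀ {x y xs ys} → Linked _<_ (x ∷ xs) → x ≡ y → x ∷ xs ⊆ y ∷ ys → xs ⊆ ys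
strictlySorted-tail-⊆ sorted refl ⊆ a∈xs with ⊆ (there a∈xs)
... | here refl  = ⊥-elim (<-irrefl refl (All.lookup (head<tail sorted) a∈xs))
... | there a∈ys = a∈ys

strictlySorted-⊆-antisym : ∀ {xs ys} → Linked _<_ xs → Linked _<_ ys → xs ⊆ ys → ys ⊆ xs → xs ≡ ys
strictlySorted-⊆-antisym {[]}     {[]}     _ _ _ _ = refl
strictlySorted-⊆-antisym {[]}     {y ∷ ys} _ _ _ ⊇ = ⊥-elim (¬Any[] (⊇ (here refl)))
strictlySorted-⊆-antisym {x ∷ xs} {[]}     _ _ ⊆ _ = ⊥-elim (¬Any[] (⊆ (here refl)))
strictlySorted-⊆-antisym {x ∷ xs} {y ∷ ys} xs↗ ys↗ ⊆ ⊇ =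
  cong₂ _∷_ x≡y (strictlySorted-⊆-antisym (Linked.tail xs↗) (Linked.tail ys↗)
                  (strictlySorted-tail-⊆ xs↗ x≡y ⊆) (strictlySorted-tail-⊆ ys↗ (sym x≡y) ⊇))
  where
  x≡y : x ≡ y
  x≡y with ⊆ (here refl) | ⊇ (here refl)
  ... | here x≡y  | _          = x≡y
  ... | there _   | here y≡x   = sym y≡x
  ... | there x∈ys | there y∈xs =
    ⊥-elim (<-asym (All.lookup (head<tail ys↗) x∈ys) (All.lookup (head<tail xs↗) y∈xs))

Letter : FSet → Set
Letter S = Canonical S × Nonempty S

ShorterOrEqual : List FSet → Word → Set
ShorterOrEqual τ x = length τ < length x ⊎ τ ≡ x

[]-shorterOrEqual : ∀ x → ShorterOrEqual [] x
[]-shorterOrEqual []      = inj₂ refl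
[]-shorterOrEqual (_ ∷ _) = inj₁ (s≤s z≤n)

shorterOrEqual⇒≤ : ∀ {τ x} → ShorterOrEqual τ x → length τ ≤ length x
shorterOrEqual⇒≤ (inj₁ τ<x)  = <⇒≤ τ<x
shorterOrEqual⇒≤ (inj₂ refl) = ≤-refl

-- A block u with support S has length at least 1, and exactly 1 only if u = α_S.
∷-shorterOrEqual : ∀ {S τ u v} → Letter S → All Letter u → T (support u ≐ᵇ S) →
                   ShorterOrEqual τ v → ShorterOrEqual (S ∷ τ) (u ++ v)
∷-shorterOrEqual {S = []}    (_ , S≢[]) _ _ _ = ⊥-elim (S≢[] refl)
∷-shorterOrEqual {S = S@(_ ∷ _)} {u = []} _ _ supp≐S _ = ⊥-elim (¬Any[] (≐ᵇ⇒⊇ {[]} {S} supp≐S (here refl)))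
∷-shorterOrEqual {S = S} {τ} {y ∷ []} {v} ((S↗ , _) , _) (((y↗ , _) , _) ∷ []) supp≐S τ⊴v =
  subst (λ Y → ShorterOrEqual (S ∷ τ) (Y ∷ v)) (sym y≡S) (∷⁺ τ⊴v)
  where
  y≐S : T (y ≐ᵇ S)
  y≐S = subst (λ Y → T (Y ≐ᵇ S)) (++-identityʳ y) supp≐S
  y≡S : y ≡ S
  y≡S = strictlySorted-⊆-antisym y↗ S↗ (≐ᵇ⇒⊆ y≐S) (≐ᵇ⇒⊇ {y} y≐S)
  ∷⁺ : ShorterOrEqual τ v → ShorterOrEqual (S ∷ τ) (S ∷ v)
  ∷⁺ (inj₁ τ<v)  = inj₁ (s≤s τ<v)
  ∷⁺ (inj₂ refl) = inj₂ refl
∷-shorterOrEqual {u = _ ∷ _ ∷ u} {v} _ _ _ τ⊴v =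
  inj₁ (s≤s (s≤s (≤-trans (shorterOrEqual⇒≤ τ⊴v) (subst (length v ≤_) (sym (length-++ u)) (m≤n+m _ _)))))

module _ {a ℓ} (M : CommutativeMonoid a ℓ) where
  open CommutativeMonoid M
  open MonoidSum M using (sum; sum-remove; sum-cong-≋; sum-replicate-zero)

  sum-single : ∀ {n} (t : Fin n → Carrier) i → (∀ j → j ≢ i → t j ≈ ε) → sum t ≈ t i
  sum-single {suc n} t i others = begin
    sum t                        ≈⟨ sum-remove {i = i} t ⟩
    t i ∙ sum (t ∘ punchIn i)    ≈⟨ ∙-congˡ (sum-cong-≋ {n} (λ j → others (punchIn i j) (punchInᵢ≢i i j))) ⟩
    t i ∙ sum {n} (λ _ → ε)      ≈⟨ ∙-congˡ (sum-replicate-zero n) ⟩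
    t i ∙ ε                      ≈⟨ identityʳ (t i) ⟩
    t i                          ∎
    where open ≈-Reasoning setoid

module _ {c ℓ : Level} (k : Field c ℓ) where
  open Field k hiding (zero) renaming (refl to ≈-refl; sym to ≈-sym; trans to ≈-trans; reflexive to ≈-reflexive)
  open TwistedDescent k

  AllWords : (Word → Set) → LinComb → Set c
  AllWords P = All (P ∘ proj₂)

  coeff-++ : ∀ xs ys w → coeff (xs ++ ys) w ≈ coeff xs w + coeff ys w
  coeff-++ []            ys w = ≈-sym (+-identityˡ _)
  coeff-++ ((a , u) ∷ xs) ys w with u ≟W w
  ... | yes _ = ≈-trans (+-congˡ (coeff-++ xs ys w)) (≈-sym (+-assoc _ _ _))
  ... | no  _ = coeff-++ xs ys w

  coeff-scale : ∀ a xs w → coeff (scale a xs) w ≈ a * coeff xs w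
  coeff-scale a []            w = ≈-sym (zeroʳ a)
  coeff-scale a ((b , u) ∷ xs) w with u ≟W w
  ... | yes _ = ≈-trans (+-congˡ (coeff-scale a xs w)) (≈-sym (distribˡ a b _))
  ... | no  _ = coeff-scale a xs w

  coeff-absent : ∀ {xs w} → AllWords (_≢ w) xs → coeff xs w ≈ 0#
  coeff-absent {[]}          []          = ≈-refl
  coeff-absent {(a , u) ∷ xs} {w} (u≢w ∷ xs∌w) with u ≟W w
  ... | yes u≡w = ⊥-elim (u≢w u≡w)
  ... | no  _   = coeff-absent xs∌w

  coeff-singleton : ∀ a u → coeff ((a , u) ∷ []) u ≈ a
  coeff-singleton a u with u ≟W u
  ... | yes _   = +-identityʳ a
  ... | no  u≢u = ⊥-elim (u≢u refl)

  coeff-mulLC-singleton : ∀ a u ys w → coeff (mulLC ((a , u) ∷ []) ys) (u ++ w) ≈ a * coeff ys w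
  coeff-mulLC-singleton a u []             w = ≈-sym (zeroʳ a)
  coeff-mulLC-singleton a u ((b , v) ∷ ys) w with (u ++ v) ≟W (u ++ w) | v ≟W w
  ... | yes _     | yes _   = ≈-trans (+-congˡ (coeff-mulLC-singleton a u ys w)) (≈-sym (distribˡ a b _))
  ... | yes uv≡uw | no v≢w  = ⊥-elim (v≢w (++-cancelˡ u v w uv≡uw))
  ... | no uv≢uw  | yes v≡w = ⊥-elim (uv≢uw (cong (u ++_) v≡w))
  ... | no _      | no _    = coeff-mulLC-singleton a u ys w

  mulLC-AllWords : ∀ {P Q R : Word → Set} {xs ys} → AllWords P xs → AllWords Q ys →
                   (∀ {u v} → P u → Q v → R (u ++ v)) → AllWords R (mulLC xs ys)
  mulLC-AllWords Pxs Qys PQ⇒R = concat⁺ (map⁺ (All.map (λ Pu → map⁺ (All.map (PQ⇒R Pu) Qys)) Pxs))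

  ⊛-AllWords : ∀ {P : FSet → Set} {R : Word → Set} f g {w} →
               (∀ {u v} → All P u → All P v → AllWords R (mulLC (f u) (g v))) →
               All P w → AllWords R ((f ⊛ g) w)
  ⊛-AllWords f g hyp Pw = concat⁺ (map⁺ (All.map (λ (Pu , Pv) → hyp Pu Pv) (splits-All Pw)))

  char-AllWords : ∀ {P : Word → Set} S w → (T (support w ≐ᵇ S) → P w) → AllWords P (char S w)
  char-AllWords {P} S w hyp = onBool (support w ≐ᵇ S) hyp
    where
    onBool : ∀ b → (T b → P w) → AllWords P (if b then (1# , w) ∷ [] else [])
    onBool true  hyp = hyp _ ∷ []
    onBool false _   = []

  char-matching : ∀ S w → T (support w ≐ᵇ S) → char S w ≡ (1# , w) ∷ []
  char-matching S w = onBool (support w ≐ᵇ S)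
    where
    onBool : ∀ b → T b → (if b then (1# , w) ∷ [] else []) ≡ (1# , w) ∷ []
    onBool true _ = refl

  char-mismatching : ∀ S w → ¬ T (support w ≐ᵇ S) → char S w ≡ []
  char-mismatching S w = onBool (support w ≐ᵇ S)
    where
    onBool : ∀ b → ¬ T b → (if b then (1# , w) ∷ [] else []) ≡ []
    onBool true  ¬T = ⊥-elim (¬T _)
    onBool false _  = refl

  charProd-shorterOrEqual : ∀ τ {w} → All Letter τ → All Letter w →
                            AllWords (ShorterOrEqual τ) (charProd τ w)
  charProd-shorterOrEqual []          {w} _ _ = char-AllWords [] w (λ _ → []-shorterOrEqual w)
  charProd-shorterOrEqual (S ∷ [])    {w} (S-letter ∷ []) w-letters = char-AllWords S w
    (λ supp≐S → subst (ShorterOrEqual (S ∷ [])) (++-identityʳ w)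
                  (∷-shorterOrEqual S-letter w-letters supp≐S (inj₂ refl)))
  charProd-shorterOrEqual (S ∷ S′ ∷ τ) (S-letter ∷ τ-letters) w-letters =
    ⊛-AllWords (char S) (charProd (S′ ∷ τ))
      (λ {u} u-letters v-letters →
         mulLC-AllWords (char-AllWords {λ u′ → T (support u′ ≐ᵇ S) × All Letter u′} S u (_, u-letters))
                        (charProd-shorterOrEqual (S′ ∷ τ) τ-letters v-letters)
                        (λ (supp≐S , u-letters) → ∷-shorterOrEqual S-letter u-letters supp≐S))
      w-letters

  coeff-concat-zero : ∀ xss {w} → All (λ xs → coeff xs w ≈ 0#) xss → coeff (concat xss) w ≈ 0#
  coeff-concat-zero []         []                = ≈-refl
  coeff-concat-zero (xs ∷ xss) {w} (xs≈0 ∷ xss≈0) =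
    ≈-trans (coeff-++ xs _ w) (≈-trans (+-cong xs≈0 (coeff-concat-zero xss xss≈0)) (+-identityʳ 0#))

  coeff-++-[] : ∀ xs w → coeff (xs ++ []) w ≈ coeff xs w
  coeff-++-[] xs w = ≈-reflexive (cong (λ ys → coeff ys w) (++-identityʳ xs))

  -- Moving the first letter to either side of a split keeps a nonempty left part nonempty.
  coeff-concatMap-splits : ∀ {P : FSet → Set} (D : Word × Word → LinComb) y {w} → All P w →
                           (∀ {u v} → All P u → u ≢ [] → coeff (D (u , v)) y ≈ 0#) →
                           coeff (concatMap D (splits w)) y ≈ coeff (D ([] , w)) y
  coeff-concatMap-splits D y []         _         = coeff-++-[] (D ([] , [])) y
  coeff-concatMap-splits {P} D y {a ∷ w} (Pa ∷ Pw) vanish = begin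
    coeff (concatMap D (splits (a ∷ w))) y
      ≡⟨ cong (λ L → coeff L y) (concatMap-concatMap D _ (splits w)) ⟩
    coeff (concatMap D′ (splits w)) y
      ≈⟨ coeff-concatMap-splits D′ y Pw vanish′ ⟩
    coeff (D ((a ∷ []) , w) ++ (D ([] , a ∷ w) ++ [])) y
      ≈⟨ coeff-++ (D ((a ∷ []) , w)) _ y ⟩
    coeff (D ((a ∷ []) , w)) y + coeff (D ([] , a ∷ w) ++ []) y
      ≈⟨ +-cong (vanish (Pa ∷ []) (λ ())) (coeff-++-[] (D ([] , a ∷ w)) y) ⟩
    0# + coeff (D ([] , a ∷ w)) y
      ≈⟨ +-identityˡ _ ⟩
    coeff (D ([] , a ∷ w)) y ∎
    where
    open ≈-Reasoning setoid
    D′ : Word × Word → LinComb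
    D′ (u , v) = D (a ∷ u , v) ++ (D (u , a ∷ v) ++ [])
    vanish′ : ∀ {u v} → All P u → u ≢ [] → coeff (D′ (u , v)) y ≈ 0#
    vanish′ {u} {v} Pu u≢[] =
      coeff-concat-zero (D (a ∷ u , v) ∷ D (u , a ∷ v) ∷ []) (vanish (Pa ∷ Pu) (λ ()) ∷ vanish Pu u≢[] ∷ [])

  char-self : ∀ S → char S (S ∷ []) ≡ (1# , S ∷ []) ∷ []
  char-self S = char-matching S (S ∷ []) (subst (λ Y → T (Y ≐ᵇ S)) (sym (++-identityʳ S)) (≐ᵇ-refl S))

  coeff-char⊛-cons : ∀ {S w} → Nonempty S → All (λ S′ → Nonempty S′ × Disjoint S S′) w →
                     ∀ g x → coeff ((char S ⊛ g) (S ∷ w)) (S ∷ x) ≈ coeff (g w) x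
  coeff-char⊛-cons {[]}        S≢[] _ _ _ = ⊥-elim (S≢[] refl)
  coeff-char⊛-cons {S@(s ∷ _)} {w} _ letters g x = begin
    coeff ((char S ⊛ g) (S ∷ w)) (S ∷ x)
      ≡⟨ cong (λ L → coeff L (S ∷ x)) (concatMap-concatMap _ _ (splits w)) ⟩
    coeff (concatMap D (splits w)) (S ∷ x)
      ≈⟨ coeff-concatMap-splits D (S ∷ x) letters vanish ⟩
    -- the second half of D ([] , w) vanishes because char S [] computes to [] for S nonempty
    coeff (mulLC (char S (S ∷ [])) (g w) ++ []) (S ∷ x)
      ≈⟨ coeff-++-[] (mulLC (char S (S ∷ [])) (g w)) (S ∷ x) ⟩
    coeff (mulLC (char S (S ∷ [])) (g w)) (S ∷ x)
      ≡⟨ cong (λ c → coeff (mulLC c (g w)) (S ∷ x)) (char-self S) ⟩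
    coeff (mulLC ((1# , S ∷ []) ∷ []) (g w)) (S ∷ x)
      ≈⟨ coeff-mulLC-singleton 1# (S ∷ []) (g w) x ⟩
    1# * coeff (g w) x
      ≈⟨ *-identityˡ _ ⟩
    coeff (g w) x ∎
    where
    open ≈-Reasoning setoid
    D : Word × Word → LinComb
    D (u , v) = mulLC (char S (S ∷ u)) (g v) ++ (mulLC (char S u) (g (S ∷ v)) ++ [])
    S≢ : ∀ {S′} → Disjoint S S′ → S′ ≢ S
    S≢ S#S′ refl = S#S′ s (here refl) (here refl)
    vanish : ∀ {u v} → All (λ S′ → Nonempty S′ × Disjoint S S′) u → u ≢ [] → coeff (D (u , v)) (S ∷ x) ≈ 0#
    vanish {[]} _ []≢[] = ⊥-elim ([]≢[] refl)
    vanish {[] ∷ _} ((u₀≢[] , _) ∷ _) _ = ⊥-elim (u₀≢[] refl)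
    vanish {u@((a ∷ _) ∷ u′)} {v} ((_ , S#u₀) ∷ _) _ =
      coeff-concat-zero (mulLC (char S (S ∷ u)) (g v) ∷ mulLC (char S u) (g (S ∷ v)) ∷ [])
                        (S∷u-unmatched ∷ starts-with-u₀ ∷ [])
      where
      S∷u-mismatch : ¬ T (support (S ∷ u) ≐ᵇ S)
      S∷u-mismatch supp≐S = S#u₀ a (≐ᵇ⇒⊆ supp≐S (∈-++⁺ʳ S (∈-++⁺ˡ {ys = support u′} (here refl)))) (here refl)
      S∷u-unmatched : coeff (mulLC (char S (S ∷ u)) (g v)) (S ∷ x) ≈ 0#
      S∷u-unmatched = ≈-reflexive (cong (λ c → coeff (mulLC c (g v)) (S ∷ x)) (char-mismatching S (S ∷ u) S∷u-mismatch))
      starts-with-u₀ : coeff (mulLC (char S u) (g (S ∷ v))) (S ∷ x) ≈ 0#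
      starts-with-u₀ = coeff-absent (mulLC-AllWords (char-AllWords {_≡ u} S u (λ _ → refl))
                                             (All.universal (λ _ → tt) (g (S ∷ v)))
                                             (λ { refl _ u++≡ → S≢ S#u₀ (∷-injectiveˡ u++≡) }))

  charProd-diagonal : ∀ {σ} → ValidWord σ → coeff (charProd σ σ) σ ≈ 1#
  charProd-diagonal {[]}     _ = coeff-singleton 1# []
  charProd-diagonal {S ∷ []} _ =
    ≈-trans (≈-reflexive (cong (λ L → coeff L (S ∷ [])) (char-self S))) (coeff-singleton 1# (S ∷ []))
  charProd-diagonal {S ∷ S′ ∷ τ} (((_ , S≢[]) ∷ letters) , (S#τ ∷ disjoint)) =
    ≈-trans (coeff-char⊛-cons S≢[] (All.zip (All.map proj₂ letters , S#τ)) (charProd (S′ ∷ τ)) (S′ ∷ τ))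
            (charProd-diagonal (letters , disjoint))

  charProd-offDiagonal : ∀ {τ w} → All Letter τ → All Letter w → ¬ length τ < length w → τ ≢ w →
                         coeff (charProd τ w) w ≈ 0#
  charProd-offDiagonal {τ} {w} τ-letters w-letters τ≮w τ≢w =
    coeff-absent (All.map excluded (charProd-shorterOrEqual τ τ-letters w-letters))
    where
    excluded : ∀ {x} → ShorterOrEqual τ x → x ≢ w
    excluded (inj₁ τ<x)  refl = τ≮w τ<x
    excluded (inj₂ refl) refl = τ≢w refl

  open MonoidSum +-commutativeMonoid using (sum; sum-cong-≋)

  coeff-concatMap-tabulate : ∀ {a} {A : Set a} {n} (H : A → LinComb) (f : Fin n → A) w →
                             coeff (concatMap H (tabulate f)) w ≈ sum (λ j → coeff (H (f j)) w)
  coeff-concatMap-tabulate {n = zero}  H f w = ≈-refl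
  coeff-concatMap-tabulate {n = suc n} H f w =
    ≈-trans (coeff-++ (H (f zero)) _ w) (+-congˡ (coeff-concatMap-tabulate H (f ∘ suc) w))

  coeff-linComb : ∀ {n} cs (F : Fin n → End) w v →
                  coeff (linComb cs F w) v ≈ sum (λ j → cs j * coeff (F j w) v)
  coeff-linComb cs F w v =
    ≈-trans (coeff-concatMap-tabulate (λ j → scale (cs j) (F j w)) (λ j → j) v)
            (sum-cong-≋ (λ j → coeff-scale (cs j) (F j w) v))

  coeff-linComb-single : ∀ {n} cs (F : Fin n → End) w v i →
                         (∀ j → j ≢ i → cs j * coeff (F j w) v ≈ 0#) →
                         coeff (linComb cs F w) v ≈ cs i * coeff (F i w) v
  coeff-linComb-single cs F w v i others = ≈-trans (coeff-linComb cs F w v) (sum-single +-commutativeMonoid _ i others)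

mainTheorem4 : {c ℓ : Level} (k : Field c ℓ) (n : ℕ) (σ : Fin n → List FSet)
    → (∀ i → AdmissibleSeq (σ i))
    → Injective _≡_ _≡_ σ
    → (cs : Fin n → Field.Carrier k)
    → TwistedDescent.IsZeroEnd k (TwistedDescent.linComb k cs (λ i → TwistedDescent.charProd k (σ i)))
    → ∀ i → Field._≈_ k (cs i) (Field.0# k)
mainTheorem4 k n σ valid inj cs vanishes =
  WF.All.wfRec (On.wellFounded (length ∘ σ) <-wellFounded) _ (λ i → cs i ≈ 0#) cᵢ≈0
  where
  open Field k using (_≈_; _*_; 0#; 1#; setoid; *-identityʳ; *-congˡ; *-congʳ; zeroˡ; zeroʳ)
    renaming (trans to ≈-trans)
  open TwistedDescent k
  open ≈-Reasoning setoid
  cᵢ≈0 : ∀ i → (∀ {j} → length (σ j) < length (σ i) → cs j ≈ 0#) → cs i ≈ 0#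
  cᵢ≈0 i shorter≈0 = begin
    cs i                                           ≈⟨ *-identityʳ (cs i) ⟨
    cs i * 1#                                      ≈⟨ *-congˡ (charProd-diagonal k (valid i)) ⟨
    cs i * coeff (charProd (σ i) (σ i)) (σ i)      ≈⟨ coeff-linComb-single k cs (charProd ∘ σ) (σ i) (σ i) i others ⟨
    coeff (linComb cs (charProd ∘ σ) (σ i)) (σ i)  ≈⟨ vanishes (σ i) (valid i) (σ i) ⟩
    0#                                             ∎
    where
    others : ∀ j → j ≢ i → cs j * coeff (charProd (σ j) (σ i)) (σ i) ≈ 0#
    others j j≢i with length (σ j) <? length (σ i)
    ... | yes shorter = ≈-trans (*-congʳ (shorter≈0 shorter)) (zeroˡ _)
    ... | no ¬shorter = ≈-trans (*-congˡ (charProd-offDiagonal k (proj₁ (valid j)) (proj₁ (valid i))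
                                                               ¬shorter (j≢i ∘ inj)))
                                (zeroʳ _)
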